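{- Let $G$ be a finite simple complete bipartite graph. If $G$ has a set graceful labeling, then $G$ is a star (i.e., one of the two parts of its bipartition consists of exactly one vertex).
   Context: All graphs are finite and simple. Let $G$ be a graph with vertex set $V$ and edge set $E$, and let $\mathcal{X}$ be the power set of some set $X$. For a function $f: V \to \mathcal{X}$, define $\hat f: E \to \mathcal{X}$ by $\hat f(xy) = f(x) \,\Delta\, f(y)$ for every edge $xy \in E$, where $A \,\Delta\, B$ denotes the symmetric difference of sets $A$ and $B$. The function $f$ is called a set graceful labeling of $G$ if both $f$ and $\hat f$ are injective and the range of $\hat f$ is exactly $\mathcal{X} \setminus \{\emptyset\}$ (i.e., the set of all nonempty subsets of $X$). -}

module Defs where

open import Data.Nat using (ℕ)
open import Data.Fin using (Fin)
open import Data.Fin.Subset using (Subset; _─_; _∪_; Nonempty)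
open import Data.Product using (_×_; _,_; ∃)
open import Data.Sum using (_⊎_; inj₁; inj₂)
open import Function.Definitions using (Injective)
open import Relation.Binary.PropositionalEquality using (_≡_)

_Δ_ : ∀ {k} → Subset k → Subset k → Subset k
A Δ B = (A ─ B) ∪ (B ─ A)

-- A finite simple graph presented by its vertex type V, its edge type E
-- (one element per edge) and the endpoints of each edge.
-- Induced edge labeling  f̂(xy) = f(x) Δ f(y).
edgeLabel : ∀ {V E : Set} {k} → (E → V × V) → (V → Subset k) → E → Subset k
edgeLabel ends f e with ends e
... | (x , y) = f x Δ f y

record IsSetGraceful {V E : Set} (ends : E → V × V) (k : ℕ)
                     (f : V → Subset k) : Set where
  field
    f-injective  : Injective _≡_ _≡_ f
    f̂-injective  : Injective _≡_ _≡_ (edgeLabel ends f)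
    f̂-nonempty   : ∀ e → Nonempty (edgeLabel ends f e)
    f̂-surjective : ∀ (S : Subset k) → Nonempty S → ∃ λ e → edgeLabel ends f e ≡ S

Kends : (m n : ℕ) → Fin m × Fin n → (Fin m ⊎ Fin n) × (Fin m ⊎ Fin n)
Kends m n (i , j) = inj₁ i , inj₂ j

HasSetGracefulLabeling : {V E : Set} → (E → V × V) → Set
HasSetGracefulLabeling {V} ends = ∃ λ (k : ℕ) → ∃ λ (f : V → Subset k) → IsSetGraceful ends k f

-- Identify 𝒫(X) with the group F₂ᵏ under Δ and let A, B be the label families of the two
-- parts, α(T) = Σ_{a∈A} χ_T(a), β(T) = Σ_{b∈B} χ_T(b) their character sums.  Since the edge
-- labels a Δ b run exactly once through the nonempty subsets, α(T) β(T) = 2ᵏ [T = ∅] - 1.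
-- At T = ∅ this reads m n = 2ᵏ - 1; for T ≠ ∅ it gives α(T) β(T) = -1, hence α(T)² = 1.
-- Parseval (A has m distinct elements) gives Σ_T α(T)² = 2ᵏ m, while the values just found
-- give Σ_T α(T)² = m² + 2ᵏ - 1.  Together: m (m - 1) (n - 1) = 0.
module Submission where

open import Defs
open import Data.Nat using (ℕ; _≥_; zero; suc; _^_)
open import Data.Sum using (_⊎_; inj₁; inj₂)
open import Data.Sum.Properties using (inj₁-injective)
open import Relation.Binary.PropositionalEquality
  using (_≡_; _≢_; _≗_; refl; sym; trans; cong; cong₂; module ≡-Reasoning)

open import Data.Bool using (Bool; true; false; _xor_)
open import Data.Empty using (⊥-elim)
open import Data.Fin using (Fin; punchIn)
open import Data.Fin.Properties using (punchInᵢ≢i)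
open import Data.Fin.Subset using (Subset; ⊥; Nonempty; inside; outside)
open import Data.Fin.Subset.Properties using (nonempty?; Empty-unique; ∉⊥)
import Data.Nat.Properties as ℕ
open import Data.Integer using (ℤ; +_; -[1+_]; 0ℤ; 1ℤ; -1ℤ; _+_; _*_; _-_; ∣_∣)
open import Data.Integer.Properties
  using (+-*-semiring; *-identityˡ; *-identityʳ; *-zeroʳ; +-identityʳ;
         pos-+; pos-*; abs-*; +-injective; i-j≡0⇒i≡j; i*j≡0⇒i≡0∨j≡0)
open import Data.Integer.Tactic.RingSolver using (solve-∀)
open import Data.Product using (_×_; _,_; proj₁; proj₂; ∃)
open import Data.Vec using ([]; _∷_)
open import Data.Vec.Properties using (≡-dec)
import Data.Bool.Properties as Bool
open import Function using (_∘_)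
open import Function.Definitions using (Injective)
open import Relation.Nullary using (yes; no; contradiction)

open import Algebra.Properties.Semiring.Sum +-*-semiring
  using (sum; sum-syntax; sum-cong-≗; sum-remove; sum-replicate-zero;
         ∑-distrib-+; *-distribˡ-sum; *-distribʳ-sum)

open ≡-Reasoning

*≡-1⇒²≡1 : ∀ x y → x * y ≡ -1ℤ → x * x ≡ 1ℤ
*≡-1⇒²≡1 x y xy≡-1 = ∣x∣≡1⇒x²≡1 x (ℕ.m*n≡1⇒m≡1 ∣ x ∣ ∣ y ∣ (trans (sym (abs-* x y)) (cong ∣_∣ xy≡-1)))
  where
  ∣x∣≡1⇒x²≡1 : ∀ x → ∣ x ∣ ≡ 1 → x * x ≡ 1ℤ
  ∣x∣≡1⇒x²≡1 (+ 1)      _ = refl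
  ∣x∣≡1⇒x²≡1 -[1+ 0 ]   _ = refl
  ∣x∣≡1⇒x²≡1 (+ 0)      ()
  ∣x∣≡1⇒x²≡1 (+ suc (suc _)) ()
  ∣x∣≡1⇒x²≡1 -[1+ suc _ ] ()

m[m-1][n-1]≡0 : ∀ m n P → + m * + n + 1ℤ ≡ P → P + (+ m * + m - 1ℤ) ≡ + m * P →
                + m * ((+ m - 1ℤ) * (+ n - 1ℤ)) ≡ 0ℤ
m[m-1][n-1]≡0 m n P mn+1≡P P+m²-1≡mP = begin
  M * ((M - 1ℤ) * (N - 1ℤ))                                        ≡⟨ identity M N P ⟩
  (M - 1ℤ) * ((M * N + 1ℤ) - P) - ((P + (M * M - 1ℤ)) - M * P)     ≡⟨ cong₂ (λ u v → (M - 1ℤ) * (u - P) - (v - M * P)) mn+1≡P P+m²-1≡mP ⟩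
  (M - 1ℤ) * (P - P) - (M * P - M * P)                              ≡⟨ vanishing M P (M * P) ⟩
  0ℤ                                                                ∎
  where
  M N : ℤ
  M = + m
  N = + n
  identity : ∀ M N P → M * ((M - 1ℤ) * (N - 1ℤ)) ≡ (M - 1ℤ) * ((M * N + 1ℤ) - P) - ((P + (M * M - 1ℤ)) - M * P)
  identity = solve-∀
  vanishing : ∀ M P Q → (M - 1ℤ) * (P - P) - (Q - Q) ≡ 0ℤ
  vanishing = solve-∀

m[m-1][n-1]≡0⇒m≡0⊎m≡1⊎n≡1 : ∀ m n → + m * ((+ m - 1ℤ) * (+ n - 1ℤ)) ≡ 0ℤ → m ≡ 0 ⊎ m ≡ 1 ⊎ n ≡ 1
m[m-1][n-1]≡0⇒m≡0⊎m≡1⊎n≡1 m n product≡0 with i*j≡0⇒i≡0∨j≡0 (+ m) product≡0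
... | inj₁ m≡0 = inj₁ (+-injective m≡0)
... | inj₂ [m-1][n-1]≡0 with i*j≡0⇒i≡0∨j≡0 (+ m - 1ℤ) [m-1][n-1]≡0
...   | inj₁ m-1≡0 = inj₂ (inj₁ (+-injective (i-j≡0⇒i≡j (+ m) 1ℤ m-1≡0)))
...   | inj₂ n-1≡0 = inj₂ (inj₂ (+-injective (i-j≡0⇒i≡j (+ n) 1ℤ n-1≡0)))

∑-const : ∀ n c → ∑[ i < n ] c ≡ + n * c
∑-const zero    c = refl
∑-const (suc n) c = begin
  c + ∑[ i < n ] c  ≡⟨ cong (_+_ c) (∑-const n c) ⟩
  c + + n * c       ≡⟨ collect (+ n) c ⟩
  (1ℤ + + n) * c    ≡⟨ cong (_* c) (pos-+ 1 n) ⟨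
  + suc n * c       ∎
  where
  collect : ∀ x c → c + x * c ≡ (1ℤ + x) * c
  collect = solve-∀

∑-zero : ∀ {n} {g : Fin n → ℤ} → (∀ i → g i ≡ 0ℤ) → ∑[ i < n ] g i ≡ 0ℤ
∑-zero {n} g≡0 = trans (sum-cong-≗ g≡0) (sum-replicate-zero n)

∑-single : ∀ {n} (g : Fin n → ℤ) i₀ → (∀ i → i ≢ i₀ → g i ≡ 0ℤ) → ∑[ i < n ] g i ≡ g i₀
∑-single {suc n} g i₀ g≡0 = begin
  sum g                                ≡⟨ sum-remove {i = i₀} g ⟩
  g i₀ + ∑[ j < n ] g (punchIn i₀ j)   ≡⟨ cong (_+_ (g i₀)) (∑-zero (λ j → g≡0 _ (punchInᵢ≢i i₀ j))) ⟩
  g i₀ + 0ℤ                            ≡⟨ +-identityʳ (g i₀) ⟩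
  g i₀                                 ∎

sum-*-sum : ∀ {m n} (u : Fin m → ℤ) (w : Fin n → ℤ) →
            sum u * sum w ≡ ∑[ i < m ] ∑[ j < n ] (u i * w j)
sum-*-sum u w = trans (*-distribʳ-sum (sum w) u) (sum-cong-≗ (λ i → *-distribˡ-sum (u i) w))

-- Sums over the subsets of Fin k

∑ˢ : ∀ k → (Subset k → ℤ) → ℤ
∑ˢ zero    g = g []
∑ˢ (suc k) g = ∑ˢ k λ S → g (outside ∷ S) + g (inside ∷ S)

∑ˢ-cong : ∀ {k} {g h : Subset k → ℤ} → g ≗ h → ∑ˢ k g ≡ ∑ˢ k h
∑ˢ-cong {zero}  g≗h = g≗h []
∑ˢ-cong {suc k} g≗h = ∑ˢ-cong (λ S → cong₂ _+_ (g≗h (outside ∷ S)) (g≗h (inside ∷ S)))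

∑ˢ-distrib-+ : ∀ {k} (g h : Subset k → ℤ) → ∑ˢ k (λ S → g S + h S) ≡ ∑ˢ k g + ∑ˢ k h
∑ˢ-distrib-+ {zero}  g h = refl
∑ˢ-distrib-+ {suc k} g h = trans
  (∑ˢ-cong (λ S → interchange (g (outside ∷ S)) (h (outside ∷ S)) (g (inside ∷ S)) (h (inside ∷ S))))
  (∑ˢ-distrib-+ {k} _ _)
  where
  interchange : ∀ a b c d → (a + b) + (c + d) ≡ (a + c) + (b + d)
  interchange = solve-∀

*-distribˡ-∑ˢ : ∀ {k} c (g : Subset k → ℤ) → c * ∑ˢ k g ≡ ∑ˢ k (λ S → c * g S)
*-distribˡ-∑ˢ {zero}  c g = refl
*-distribˡ-∑ˢ {suc k} c g = trans (*-distribˡ-∑ˢ {k} c _) (∑ˢ-cong (λ S → distribˡ c (g (outside ∷ S)) (g (inside ∷ S))))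
  where
  distribˡ : ∀ c a b → c * (a + b) ≡ c * a + c * b
  distribˡ = solve-∀

∑ˢ-const : ∀ k c → ∑ˢ k (λ _ → c) ≡ + (2 ^ k) * c
∑ˢ-const zero    c = sym (*-identityˡ c)
∑ˢ-const (suc k) c = begin
  ∑ˢ k (λ _ → c + c)       ≡⟨ ∑ˢ-const k (c + c) ⟩
  + (2 ^ k) * (c + c)      ≡⟨ collect (+ (2 ^ k)) c ⟩
  (+ 2 * + (2 ^ k)) * c    ≡⟨ cong (_* c) (pos-* 2 (2 ^ k)) ⟨
  + (2 ^ suc k) * c        ∎
  where
  collect : ∀ p c → p * (c + c) ≡ (+ 2 * p) * c
  collect = solve-∀

∑ˢ-∑-comm : ∀ {k m} (g : Fin m → Subset k → ℤ) → ∑ˢ k (λ S → ∑[ i < m ] g i S) ≡ ∑[ i < m ] ∑ˢ k (g i)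
∑ˢ-∑-comm {zero}  g = refl
∑ˢ-∑-comm {suc k} g = trans
  (∑ˢ-cong (λ S → sym (∑-distrib-+ (λ i → g i (outside ∷ S)) (λ i → g i (inside ∷ S)))))
  (∑ˢ-∑-comm (λ i S → g i (outside ∷ S) + g i (inside ∷ S)))

δᵇ : Bool → Bool → ℤ
δᵇ true  true  = 1ℤ
δᵇ false false = 1ℤ
δᵇ true  false = 0ℤ
δᵇ false true  = 0ℤ

δ : ∀ {k} → Subset k → Subset k → ℤ
δ []      []      = 1ℤ
δ (b ∷ x) (c ∷ y) = δᵇ b c * δ x y

δ-refl : ∀ {k} (x : Subset k) → δ x x ≡ 1ℤ
δ-refl []          = refl
δ-refl (true  ∷ x) = trans (*-identityˡ _) (δ-refl x)
δ-refl (false ∷ x) = trans (*-identityˡ _) (δ-refl x)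

δ-≢ : ∀ {k} {x y : Subset k} → x ≢ y → δ x y ≡ 0ℤ
δ-≢ {x = []}        {[]}        x≢y = ⊥-elim (x≢y refl)
δ-≢ {x = true  ∷ x} {true  ∷ y} x≢y = trans (*-identityˡ _) (δ-≢ (x≢y ∘ cong (true ∷_)))
δ-≢ {x = false ∷ x} {false ∷ y} x≢y = trans (*-identityˡ _) (δ-≢ (x≢y ∘ cong (false ∷_)))
δ-≢ {x = true  ∷ x} {false ∷ y} x≢y = refl
δ-≢ {x = false ∷ x} {true  ∷ y} x≢y = refl

∑ˢ-δ : ∀ {k} (x : Subset k) (g : Subset k → ℤ) → ∑ˢ k (λ S → δ x S * g S) ≡ g x
∑ˢ-δ []          g = *-identityˡ (g [])
∑ˢ-δ (false ∷ x) g = trans (∑ˢ-cong (λ S → keep-outside (δ x S) (g (false ∷ S)) (g (true ∷ S)))) (∑ˢ-δ x (g ∘ (false ∷_)))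
  where
  keep-outside : ∀ d a b → (1ℤ * d) * a + (0ℤ * d) * b ≡ d * a
  keep-outside = solve-∀
∑ˢ-δ (true  ∷ x) g = trans (∑ˢ-cong (λ S → keep-inside (δ x S) (g (false ∷ S)) (g (true ∷ S)))) (∑ˢ-δ x (g ∘ (true ∷_)))
  where
  keep-inside : ∀ d a b → (0ℤ * d) * a + (1ℤ * d) * b ≡ d * b
  keep-inside = solve-∀

∑ˢ-except : ∀ {k} (g h : Subset k → ℤ) x → (∀ S → S ≢ x → g S ≡ h S) → ∑ˢ k g ≡ ∑ˢ k h + (g x - h x)
∑ˢ-except {k} g h x g≡h = begin
  ∑ˢ k g                                       ≡⟨ ∑ˢ-cong split ⟩
  ∑ˢ k (λ S → h S + δ x S * (g x - h x))       ≡⟨ ∑ˢ-distrib-+ h _ ⟩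
  ∑ˢ k h + ∑ˢ k (λ S → δ x S * (g x - h x))    ≡⟨ cong (_+_ (∑ˢ k h)) (∑ˢ-δ x (λ _ → g x - h x)) ⟩
  ∑ˢ k h + (g x - h x)                         ∎
  where
  split : ∀ S → g S ≡ h S + δ x S * (g x - h x)
  split S with ≡-dec Bool._≟_ S x
  ... | yes refl = trans (add-difference (g S) (h S)) (cong (λ d → h S + d * (g S - h S)) (sym (δ-refl S)))
    where
    add-difference : ∀ a b → a ≡ b + 1ℤ * (a - b)
    add-difference = solve-∀
  ... | no S≢x = begin
    g S                       ≡⟨ g≡h S S≢x ⟩
    h S                       ≡⟨ add-zero (h S) (g x - h x) ⟩
    h S + 0ℤ * (g x - h x)    ≡⟨ cong (λ d → h S + d * (g x - h x)) (δ-≢ (S≢x ∘ sym)) ⟨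
    h S + δ x S * (g x - h x) ∎
    where
    add-zero : ∀ a b → a ≡ a + 0ℤ * b
    add-zero = solve-∀

-- Characters of (Subset k, Δ)

sgn : Bool → Bool → ℤ
sgn true true = -1ℤ
sgn _    _    = 1ℤ

χ : ∀ {k} → Subset k → Subset k → ℤ
χ []      []      = 1ℤ
χ (t ∷ T) (s ∷ S) = sgn t s * χ T S

Δ-∷ : ∀ {k} b c (x y : Subset k) → (b ∷ x) Δ (c ∷ y) ≡ (b xor c) ∷ (x Δ y)
Δ-∷ true  true  x y = refl
Δ-∷ true  false x y = refl
Δ-∷ false true  x y = refl
Δ-∷ false false x y = refl

sgn-xor : ∀ t b c → sgn t (b xor c) ≡ sgn t b * sgn t c
sgn-xor false b     c     = refl
sgn-xor true  true  true  = refl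
sgn-xor true  true  false = refl
sgn-xor true  false true  = refl
sgn-xor true  false false = refl

χ-Δ : ∀ {k} (T x y : Subset k) → χ T (x Δ y) ≡ χ T x * χ T y
χ-Δ []      []      []      = refl
χ-Δ (t ∷ T) (b ∷ x) (c ∷ y) = begin
  χ (t ∷ T) ((b ∷ x) Δ (c ∷ y))            ≡⟨ cong (χ (t ∷ T)) (Δ-∷ b c x y) ⟩
  sgn t (b xor c) * χ T (x Δ y)            ≡⟨ cong₂ _*_ (sgn-xor t b c) (χ-Δ T x y) ⟩
  (sgn t b * sgn t c) * (χ T x * χ T y)    ≡⟨ interchange (sgn t b) (sgn t c) (χ T x) (χ T y) ⟩
  (sgn t b * χ T x) * (sgn t c * χ T y)    ∎
  where
  interchange : ∀ a b c d → (a * b) * (c * d) ≡ (a * c) * (b * d)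
  interchange = solve-∀

χ-comm : ∀ {k} (T S : Subset k) → χ T S ≡ χ S T
χ-comm []      []      = refl
χ-comm (t ∷ T) (s ∷ S) = cong₂ _*_ (sgn-comm t s) (χ-comm T S)
  where
  sgn-comm : ∀ t s → sgn t s ≡ sgn s t
  sgn-comm true  true  = refl
  sgn-comm true  false = refl
  sgn-comm false true  = refl
  sgn-comm false false = refl

χ-⊥ : ∀ {k} (T : Subset k) → χ T ⊥ ≡ 1ℤ
χ-⊥ []          = refl
χ-⊥ (true  ∷ T) = trans (*-identityˡ _) (χ-⊥ T)
χ-⊥ (false ∷ T) = trans (*-identityˡ _) (χ-⊥ T)

χ-orthogonal : ∀ {k} (x y : Subset k) → ∑ˢ k (λ T → χ T x * χ T y) ≡ + (2 ^ k) * δ x y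
χ-orthogonal []      []      = refl
χ-orthogonal {suc k} (b ∷ x) (c ∷ y) = begin
  ∑ˢ k (λ T → (sgn false b * χ T x) * (sgn false c * χ T y) + (sgn true b * χ T x) * (sgn true c * χ T y))
    ≡⟨ ∑ˢ-cong (λ T → factor (sgn false b) (sgn false c) (sgn true b) (sgn true c) (χ T x) (χ T y)) ⟩
  ∑ˢ k (λ T → s * (χ T x * χ T y))         ≡⟨ *-distribˡ-∑ˢ s (λ T → χ T x * χ T y) ⟨
  s * ∑ˢ k (λ T → χ T x * χ T y)           ≡⟨ cong₂ _*_ (sgn-orthogonal b c) (χ-orthogonal x y) ⟩
  (+ 2 * δᵇ b c) * (+ (2 ^ k) * δ x y)     ≡⟨ regroup (+ 2) (+ (2 ^ k)) (δᵇ b c) (δ x y) ⟩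
  (+ 2 * + (2 ^ k)) * (δᵇ b c * δ x y)     ≡⟨ cong (_* (δᵇ b c * δ x y)) (pos-* 2 (2 ^ k)) ⟨
  + (2 ^ suc k) * (δᵇ b c * δ x y)         ∎
  where
  s : ℤ
  s = sgn false b * sgn false c + sgn true b * sgn true c
  sgn-orthogonal : ∀ b c → sgn false b * sgn false c + sgn true b * sgn true c ≡ + 2 * δᵇ b c
  sgn-orthogonal true  true  = refl
  sgn-orthogonal true  false = refl
  sgn-orthogonal false true  = refl
  sgn-orthogonal false false = refl
  factor : ∀ p q p′ q′ u v → (p * u) * (q * v) + (p′ * u) * (q′ * v) ≡ (p * q + p′ * q′) * (u * v)
  factor = solve-∀
  regroup : ∀ a b c d → (a * c) * (b * d) ≡ (a * b) * (c * d)
  regroup = solve-∀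

∑ˢ-χ : ∀ {k} (T : Subset k) → ∑ˢ k (χ T) ≡ + (2 ^ k) * δ T ⊥
∑ˢ-χ {k} T = begin
  ∑ˢ k (χ T)                   ≡⟨ ∑ˢ-cong (λ S → trans (χ-comm T S) (sym (trans (cong (χ S T *_) (χ-⊥ S)) (*-identityʳ _)))) ⟩
  ∑ˢ k (λ S → χ S T * χ S ⊥)    ≡⟨ χ-orthogonal T ⊥ ⟩
  + (2 ^ k) * δ T ⊥             ∎

χ̂ : ∀ {m k} → (Fin m → Subset k) → Subset k → ℤ
χ̂ {m} a T = ∑[ i < m ] χ T (a i)

χ̂-⊥ : ∀ {m k} (a : Fin m → Subset k) → χ̂ a ⊥ ≡ + m
χ̂-⊥ {m} a = begin
  ∑[ i < m ] χ ⊥ (a i)   ≡⟨ sum-cong-≗ (λ i → trans (χ-comm ⊥ (a i)) (χ-⊥ (a i))) ⟩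
  ∑[ i < m ] 1ℤ          ≡⟨ ∑-const m 1ℤ ⟩
  + m * 1ℤ               ≡⟨ *-identityʳ (+ m) ⟩
  + m                    ∎

χ̂-* : ∀ {m n k} (a : Fin m → Subset k) (b : Fin n → Subset k) T →
      χ̂ a T * χ̂ b T ≡ ∑[ i < m ] ∑[ j < n ] χ T (a i Δ b j)
χ̂-* a b T = trans (sum-*-sum (λ i → χ T (a i)) (λ j → χ T (b j))) (sum-cong-≗ (λ i → sum-cong-≗ (λ j → sym (χ-Δ T (a i) (b j)))))

parseval : ∀ {m k} (a : Fin m → Subset k) → Injective _≡_ _≡_ a →
           ∑ˢ k (λ T → χ̂ a T * χ̂ a T) ≡ + m * + (2 ^ k)
parseval {m} {k} a a-injective = begin
  ∑ˢ k (λ T → χ̂ a T * χ̂ a T)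
    ≡⟨ ∑ˢ-cong (λ T → sum-*-sum (λ i → χ T (a i)) (λ i′ → χ T (a i′))) ⟩
  ∑ˢ k (λ T → ∑[ i < m ] ∑[ i′ < m ] (χ T (a i) * χ T (a i′)))
    ≡⟨ ∑ˢ-∑-comm (λ i T → ∑[ i′ < m ] (χ T (a i) * χ T (a i′))) ⟩
  ∑[ i < m ] ∑ˢ k (λ T → ∑[ i′ < m ] (χ T (a i) * χ T (a i′)))
    ≡⟨ sum-cong-≗ (λ i → ∑ˢ-∑-comm (λ i′ T → χ T (a i) * χ T (a i′))) ⟩
  ∑[ i < m ] ∑[ i′ < m ] ∑ˢ k (λ T → χ T (a i) * χ T (a i′))
    ≡⟨ sum-cong-≗ (λ i → sum-cong-≗ (λ i′ → χ-orthogonal (a i) (a i′))) ⟩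
  ∑[ i < m ] ∑[ i′ < m ] (+ (2 ^ k) * δ (a i) (a i′))
    ≡⟨ sum-cong-≗ diagonal ⟩
  ∑[ i < m ] (+ (2 ^ k))
    ≡⟨ ∑-const m _ ⟩
  + m * + (2 ^ k)
    ∎
  where
  diagonal : ∀ i → ∑[ i′ < m ] (+ (2 ^ k) * δ (a i) (a i′)) ≡ + (2 ^ k)
  diagonal i = begin
    ∑[ i′ < m ] (+ (2 ^ k) * δ (a i) (a i′))
      ≡⟨ ∑-single (λ i′ → + (2 ^ k) * δ (a i) (a i′)) i (λ i′ i′≢i → trans (cong (_*_ (+ (2 ^ k))) (δ-≢ (i′≢i ∘ sym ∘ a-injective))) (*-zeroʳ (+ (2 ^ k)))) ⟩
    + (2 ^ k) * δ (a i) (a i)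
      ≡⟨ trans (cong (_*_ (+ (2 ^ k))) (δ-refl (a i))) (*-identityʳ (+ (2 ^ k))) ⟩
    + (2 ^ k)
      ∎

-- Reindexing a subset sum along a labelling of the nonempty subsets

Nonempty⇒≢⊥ : ∀ {k} {S : Subset k} → Nonempty S → S ≢ ⊥
Nonempty⇒≢⊥ (_ , x∈S) refl = ∉⊥ x∈S

module _ {m n k} (ℓ : Fin m × Fin n → Subset k) (ℓ-injective : Injective _≡_ _≡_ ℓ)
         (ℓ-nonempty : ∀ e → Nonempty (ℓ e)) (ℓ-onto : ∀ S → Nonempty S → ∃ λ e → ℓ e ≡ S) where

  multiplicity : Subset k → ℤ
  multiplicity S = ∑[ i < m ] ∑[ j < n ] δ (ℓ (i , j)) S

  multiplicity+δ⊥≡1 : ∀ S → multiplicity S + δ ⊥ S ≡ 1ℤ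
  multiplicity+δ⊥≡1 S with nonempty? S
  ... | yes S-nonempty with ℓ-onto S S-nonempty
  ...   | (i₀ , j₀) , ℓe₀≡S = begin
    multiplicity S + δ ⊥ S
      ≡⟨ cong₂ _+_ (∑-single (λ i → ∑[ j < n ] δ (ℓ (i , j)) S) i₀
                     (λ i i≢i₀ → ∑-zero (λ j → δ-≢ (i≢i₀ ∘ cong proj₁ ∘ hits-e₀ {i , j}))))
                   (δ-≢ (Nonempty⇒≢⊥ S-nonempty ∘ sym)) ⟩
    ∑[ j < n ] δ (ℓ (i₀ , j)) S + 0ℤ
      ≡⟨ cong (_+ 0ℤ) (∑-single (λ j → δ (ℓ (i₀ , j)) S) j₀ (λ j j≢j₀ → δ-≢ (j≢j₀ ∘ cong proj₂ ∘ hits-e₀ {i₀ , j}))) ⟩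
    δ (ℓ (i₀ , j₀)) S + 0ℤ
      ≡⟨ cong (λ x → δ x S + 0ℤ) ℓe₀≡S ⟩
    δ S S + 0ℤ
      ≡⟨ cong (_+ 0ℤ) (δ-refl S) ⟩
    1ℤ
      ∎
    where
    hits-e₀ : ∀ {e} → ℓ e ≡ S → e ≡ (i₀ , j₀)
    hits-e₀ ℓe≡S = ℓ-injective (trans ℓe≡S (sym ℓe₀≡S))
  multiplicity+δ⊥≡1 S | no S-empty with Empty-unique S-empty
  multiplicity+δ⊥≡1 .⊥ | no _ | refl =
    cong₂ _+_ (∑-zero (λ i → ∑-zero (λ j → δ-≢ (Nonempty⇒≢⊥ (ℓ-nonempty (i , j)))))) (δ-refl (⊥ {k}))

  ∑ˢ-reindex : ∀ h → ∑[ i < m ] ∑[ j < n ] h (ℓ (i , j)) + h ⊥ ≡ ∑ˢ k h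
  ∑ˢ-reindex h = begin
    ∑[ i < m ] ∑[ j < n ] h (ℓ (i , j)) + h ⊥
      ≡⟨ cong₂ _+_ (sum-cong-≗ (λ i → sum-cong-≗ (λ j → ∑ˢ-δ (ℓ (i , j)) h))) (∑ˢ-δ ⊥ h) ⟨
    ∑[ i < m ] ∑[ j < n ] ∑ˢ k (weighted (ℓ (i , j))) + ∑ˢ k (weighted ⊥)
      ≡⟨ cong (_+ ∑ˢ k (weighted ⊥)) swap ⟨
    ∑ˢ k (λ S → ∑[ i < m ] ∑[ j < n ] weighted (ℓ (i , j)) S) + ∑ˢ k (weighted ⊥)
      ≡⟨ ∑ˢ-distrib-+ (λ S → ∑[ i < m ] ∑[ j < n ] weighted (ℓ (i , j)) S) (weighted ⊥) ⟨
    ∑ˢ k (λ S → ∑[ i < m ] ∑[ j < n ] weighted (ℓ (i , j)) S + weighted ⊥ S)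
      ≡⟨ ∑ˢ-cong collapse ⟩
    ∑ˢ k h
      ∎
    where
    weighted : Subset k → Subset k → ℤ
    weighted x S = δ x S * h S
    swap : ∑ˢ k (λ S → ∑[ i < m ] ∑[ j < n ] weighted (ℓ (i , j)) S)
         ≡ ∑[ i < m ] ∑[ j < n ] ∑ˢ k (weighted (ℓ (i , j)))
    swap = trans (∑ˢ-∑-comm (λ i S → ∑[ j < n ] weighted (ℓ (i , j)) S))
                 (sum-cong-≗ (λ i → ∑ˢ-∑-comm (λ j → weighted (ℓ (i , j)))))
    collapse : ∀ S → ∑[ i < m ] ∑[ j < n ] weighted (ℓ (i , j)) S + weighted ⊥ S ≡ h S
    collapse S = begin
      ∑[ i < m ] ∑[ j < n ] (δ (ℓ (i , j)) S * h S) + δ ⊥ S * h S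
        ≡⟨ cong (_+ δ ⊥ S * h S) (trans (*-distribʳ-sum (h S) (λ i → ∑[ j < n ] δ (ℓ (i , j)) S))
                                         (sum-cong-≗ (λ i → *-distribʳ-sum (h S) (λ j → δ (ℓ (i , j)) S)))) ⟨
      multiplicity S * h S + δ ⊥ S * h S
        ≡⟨ distribʳ (h S) (multiplicity S) (δ ⊥ S) ⟨
      (multiplicity S + δ ⊥ S) * h S
        ≡⟨ cong (_* h S) (multiplicity+δ⊥≡1 S) ⟩
      1ℤ * h S
        ≡⟨ *-identityˡ (h S) ⟩
      h S
        ∎
      where
      distribʳ : ∀ c a b → (a + b) * c ≡ a * c + b * c
      distribʳ = solve-∀

module _ {m n k} {f : Fin m ⊎ Fin n → Subset k} (graceful : IsSetGraceful (Kends m n) k f) where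
  open IsSetGraceful graceful

  private
    a : Fin m → Subset k
    a = f ∘ inj₁
    b : Fin n → Subset k
    b = f ∘ inj₂

  χ̂-parts-product : ∀ T → χ̂ a T * χ̂ b T + 1ℤ ≡ + (2 ^ k) * δ T ⊥
  χ̂-parts-product T = begin
    χ̂ a T * χ̂ b T + 1ℤ                               ≡⟨ cong₂ _+_ (χ̂-* a b T) (sym (χ-⊥ T)) ⟩
    ∑[ i < m ] ∑[ j < n ] χ T (a i Δ b j) + χ T ⊥     ≡⟨ ∑ˢ-reindex (edgeLabel (Kends m n) f) f̂-injective f̂-nonempty f̂-surjective (χ T) ⟩
    ∑ˢ k (χ T)                                        ≡⟨ ∑ˢ-χ T ⟩
    + (2 ^ k) * δ T ⊥                                 ∎

  mn+1≡2ᵏ : + m * + n + 1ℤ ≡ + (2 ^ k)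
  mn+1≡2ᵏ = begin
    + m * + n + 1ℤ               ≡⟨ cong₂ (λ α β → α * β + 1ℤ) (χ̂-⊥ a) (χ̂-⊥ b) ⟨
    χ̂ a ⊥ * χ̂ b ⊥ + 1ℤ           ≡⟨ χ̂-parts-product ⊥ ⟩
    + (2 ^ k) * δ (⊥ {k}) ⊥      ≡⟨ cong (_*_ (+ (2 ^ k))) (δ-refl (⊥ {k})) ⟩
    + (2 ^ k) * 1ℤ               ≡⟨ *-identityʳ (+ (2 ^ k)) ⟩
    + (2 ^ k)                    ∎

  χ̂²≡1 : ∀ T → T ≢ ⊥ → χ̂ a T * χ̂ a T ≡ 1ℤ
  χ̂²≡1 T T≢⊥ = *≡-1⇒²≡1 (χ̂ a T) (χ̂ b T) (i-j≡0⇒i≡j (χ̂ a T * χ̂ b T) -1ℤ χ̂a*χ̂b+1≡0)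
    where
    -- x - -1ℤ reduces to x + 1ℤ
    χ̂a*χ̂b+1≡0 : χ̂ a T * χ̂ b T + 1ℤ ≡ 0ℤ
    χ̂a*χ̂b+1≡0 = begin
      χ̂ a T * χ̂ b T + 1ℤ   ≡⟨ χ̂-parts-product T ⟩
      + (2 ^ k) * δ T ⊥    ≡⟨ cong (_*_ (+ (2 ^ k))) (δ-≢ T≢⊥) ⟩
      + (2 ^ k) * 0ℤ       ≡⟨ *-zeroʳ (+ (2 ^ k)) ⟩
      0ℤ                   ∎

  2ᵏ+m²-1≡m2ᵏ : + (2 ^ k) + (+ m * + m - 1ℤ) ≡ + m * + (2 ^ k)
  2ᵏ+m²-1≡m2ᵏ = begin
    + (2 ^ k) + (+ m * + m - 1ℤ)
      ≡⟨ cong₂ (λ c α → c + (α * α - 1ℤ)) (*-identityʳ (+ (2 ^ k))) (χ̂-⊥ a) ⟨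
    + (2 ^ k) * 1ℤ + (χ̂ a ⊥ * χ̂ a ⊥ - 1ℤ)
      ≡⟨ cong (_+ (χ̂ a ⊥ * χ̂ a ⊥ - 1ℤ)) (∑ˢ-const k 1ℤ) ⟨
    ∑ˢ k (λ _ → 1ℤ) + (χ̂ a ⊥ * χ̂ a ⊥ - 1ℤ)
      ≡⟨ ∑ˢ-except (λ T → χ̂ a T * χ̂ a T) (λ _ → 1ℤ) ⊥ χ̂²≡1 ⟨
    ∑ˢ k (λ T → χ̂ a T * χ̂ a T)
      ≡⟨ parseval a (inj₁-injective ∘ f-injective) ⟩
    + m * + (2 ^ k)
      ∎

mainTheorem1 : (m n : ℕ) → m ≥ 1 → n ≥ 1 →
    HasSetGracefulLabeling (Kends m n) → m ≡ 1 ⊎ n ≡ 1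
mainTheorem1 m n m≥1 _ (k , f , graceful)
  with m[m-1][n-1]≡0⇒m≡0⊎m≡1⊎n≡1 m n (m[m-1][n-1]≡0 m n _ (mn+1≡2ᵏ graceful) (2ᵏ+m²-1≡m2ᵏ graceful))
... | inj₁ refl = contradiction m≥1 λ ()
... | inj₂ m≡1⊎n≡1 = m≡1⊎n≡1
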